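{- For all integers $r \ge 0$ and $k\ge 1$, every OBDD computing the Boolean function of $F_{r,k}$ (under any variable order) has at least $2^{rk/2}$ nodes.
   Context: For a graph $G$, the graph-based CNF $CNF(G)$ has a variable $X_u$ for each vertex $u \in V(G)$ and a variable $X_{u,v}=X_{v,u}$ for each edge $\{u,v\}\in E(G)$; its clauses are $(X_u \vee X_{u,v} \vee X_v)$, one for each edge $\{u,v\} \in E(G)$. Let $T_r$ be the complete binary tree of height $r$ (with $2^{r+1}-1$ nodes). $CT_{r,k}$ is obtained from $T_r$ by replacing each node by a clique on $k$ vertices (vertex-disjoint) and, for each edge $\{a,b\}$ of $T_r$, making all vertices of the clique of $a$ adjacent to all vertices of the clique of $b$. $F_{r,k}=CNF(CT_{r,k})$. An OBDD for a Boolean function $F$ is a rooted DAG with two sinks labelled $true$ and $false$, whose internal nodes are labelled by variables of $F$ and have two outgoing edges labelled $true$ and $false$, such that there is a fixed linear order of the variables with which the labels along every root-to-sink path comply, and the assignments read along root-to-$true$ paths are exactly the satisfying assignments of $F$. Its size is its number of nodes. -}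

module Defs where

open import Data.Nat using (ℕ; zero; suc; _+_; _<_)
open import Data.Fin as Fin using (Fin)
open import Data.Bool using (Bool; true; false; if_then_else_; _∨_)
open import Data.Sum using (_⊎_; inj₁; inj₂)
open import Data.Product using (_×_)
open import Relation.Binary.PropositionalEquality using (_≡_)
open import Function.Definitions using (Injective)

-- Graphs (simple graphs given by a vertex type, an edge type and the
-- two endpoints of each edge; each unordered edge occurs exactly once).

record Graph : Set₁ where
  field
    V    : Set
    E    : Set
    end₁ : E → V
    end₂ : E → V

-- Graph-based CNF: variables X_u (u vertex) and X_e (e edge, X_{u,v}=X_{v,u}
-- since each edge is a single element of E); one clause per edge.
CNFVar : Graph → Set
CNFVar G = Graph.V G ⊎ Graph.E G

clause : (G : Graph) → (CNFVar G → Bool) → Graph.E G → Bool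
clause G α e = α (inj₁ (Graph.end₁ G e)) ∨ α (inj₂ e) ∨ α (inj₁ (Graph.end₂ G e))

SatCNF : (G : Graph) → (CNFVar G → Bool) → Set
SatCNF G α = ∀ e → clause G α e ≡ true

-- Complete binary tree T_r of height r: nodes are addresses (paths from
-- the root of length ≤ r); there are 2^(r+1) - 1 of them.

data Node : ℕ → Set where
  here : ∀ {r} → Node r
  go   : ∀ {r} → Bool → Node r → Node (suc r)

data Child : ∀ {r} → Node r → Node r → Set where
  child-here : ∀ {r} (b : Bool) → Child {suc r} here (go b here)
  child-go   : ∀ {r} (b : Bool) {a c : Node r} → Child a c → Child (go b a) (go b c)

data CTEdge (r k : ℕ) : Set where
  clique : (a : Node r) (i j : Fin k) → i Fin.< j → CTEdge r k
  tree   : (a c : Node r) → Child a c → (i j : Fin k) → CTEdge r k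

CT : ℕ → ℕ → Graph
CT r k = record
  { V    = Node r × Fin k
  ; E    = CTEdge r k
  ; end₁ = e₁
  ; end₂ = e₂
  }
  where
  open import Data.Product using (_,_)
  e₁ : CTEdge r k → Node r × Fin k
  e₁ (clique a i j _)  = a , i
  e₁ (tree a c _ i j)  = a , i
  e₂ : CTEdge r k → Node r × Fin k
  e₂ (clique a i j _)  = a , j
  e₂ (tree a c _ i j)  = c , j

FVar : ℕ → ℕ → Set
FVar r k = CNFVar (CT r k)

-- Internal nodes are Fin n; the two sinks
-- are inj₂ true / inj₂ false.  A fixed linear order of the variables is
-- given by an injective rank function; along every edge between internal
-- nodes the rank strictly increases (so the graph is acyclic and every
-- path complies with the order).

record OBDD (X : Set) : Set where
  field
    n       : ℕ
    label   : Fin n → X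
    lo hi   : Fin n → Fin n ⊎ Bool
    root    : Fin n ⊎ Bool
    rank    : X → ℕ
    rank-inj : Injective _≡_ _≡_ rank
    lo-ord  : ∀ i j → lo i ≡ inj₁ j → rank (label i) < rank (label j)
    hi-ord  : ∀ i j → hi i ≡ inj₁ j → rank (label i) < rank (label j)

  -- number of nodes: internal nodes plus the two sinks
  size : ℕ
  size = n + 2

  data Reach (α : X → Bool) : Fin n ⊎ Bool → Bool → Set where
    sink : ∀ b → Reach α (inj₂ b) b
    node : ∀ i b → Reach α (if α (label i) then hi i else lo i) b → Reach α (inj₁ i) b

Computes : {X : Set} → OBDD X → ((X → Bool) → Set) → Set
Computes B P = ∀ α → (OBDD.Reach B α (OBDD.root B) true → P α)
                   × (P α → OBDD.Reach B α (OBDD.root B) true)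

F : (r k : ℕ) → (FVar r k → Bool) → Set
F r k = SatCNF (CT r k)

module Submission where

-- 1. Fooling sets (fooling-bound).  Fix a cut c in the variable order of an
--    OBDD.  If the assignments A s t, with s fixing the variables before c
--    and t those after it, have an accepted completion t₀ for every s, and
--    distinct s have distinct sets of accepted completions, then the state
--    at which the accepted run of A s t₀ crosses c determines s.
-- 2. Crossing matchings (matching-bound).  A matching of m edges u i v i of a
--    graph G with every u i before and every v i after the cut gives such a
--    family with 2^m members: u i gets s i, v i gets t i, the variables of
--    the matching edges are false and all others true, and then CNF(G)
--    holds iff s i ∨ t i for every i.  So the OBDD has ≥ 2^m nodes.
-- 3. Every vertex order of CT r k has a crossing matching of size ⌈r/2⌉·k
--    (large-matching): for heights 1 and 2, split the 2k pairwise adjacent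
--    vertices of the two top cliques at a median cut (clique-matching); for
--    height r + 3, order the cuts cE ≤ cM ≤ cL of matchings in three
--    grandchild subtrees E, M, L and run k disjoint strands, outside M, from
--    the vertices of E before cE to those of L after cL; each strand crosses
--    cM, which adds k edges to the matching of M (module Step).
-- Then 2^(rk) ≤ 2^(2m) ≤ size² for the matching size m ≥ ⌈r/2⌉·k.

open import Defs
open import Data.Nat using (ℕ; zero; suc; _+_; _*_; _^_; _≤_; _<_; _⊔_; z≤n; s≤s; ⌈_/2⌉; ⌊_/2⌋)
open import Data.Nat.Properties
  using ( _<?_; _≤?_; ≤-reflexive; ≤-trans; ≤-antisym; ≤-total; <⇒≤; <⇒≱; ≮⇒≥; ≰⇒>; ≤⇒≯
        ; <-≤-trans; ≤∧≢⇒<; m<n⇒m<1+n; m≤m+n; m≤m⊔n; m≤n⊔m; +-suc; +-identityʳ; +-cancelˡ-≡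
        ; +-mono-≤; +-monoˡ-≤; +-monoʳ-≤; *-monoˡ-≤; *-mono-≤; *-distribʳ-+; ^-monoʳ-≤; ^-distribˡ-+-*
        ; ⌊n/2⌋+⌈n/2⌉≡n; ⌊n/2⌋≤⌈n/2⌉; module ≤-Reasoning )
  renaming (_≟_ to _≟ℕ_)
open import Data.Fin using (Fin; zero; suc; splitAt; inject≤; finToFun; funToFin; combine)
open import Data.Fin.Properties
  using (2↔Bool; +↔⊎; injective⇒≤; funToFin-finToFin; any?; <-cmp; inject≤-injective)
  renaming (_≟_ to _≟F_)
open import Data.Fin.Permutation.Components using (transpose; transpose-inverse)
open import Data.Bool using (Bool; true; false; if_then_else_; _∨_)
open import Data.Bool.Properties using (∨-zeroʳ; ∨-identityʳ; ∨-comm; ⇔→≡) renaming (_≟_ to _≟B_)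
open import Data.Maybe using (Maybe; just; nothing)
open import Data.Sum using (_⊎_; inj₁; inj₂; [_,_])
open import Data.Sum.Properties using (inj₁-injective)
open import Data.Sum.Function.Propositional using (_⊎-↔_)
open import Data.Product using (_×_; _,_; Σ; ∃; proj₁; proj₂)
open import Data.Product.Properties using (≡-dec; ,-injective)
open import Data.Unit using (⊤; tt)
open import Data.List using (List; []; _∷_; length; filter; lookup; tabulate; allFin)
open import Data.List.Properties using (filter-none; filter-all; filter-accept; filter-reject; length-tabulate)
open import Data.List.Membership.Propositional using (_∈_)
open import Data.List.Membership.Propositional.Properties using (∈-lookup; ∈-filter⁻; ∈-allFin; ∈-tabulate⁻)
open import Data.List.Relation.Unary.All as All using (All; []; _∷_)
open import Data.List.Relation.Unary.AllPairs using ([]; _∷_)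
open import Data.List.Relation.Unary.Any as Any using ()
open import Data.List.Relation.Unary.Unique.Propositional using (Unique)
open import Data.List.Relation.Unary.Unique.Propositional.Properties using (filter⁺; tabulate⁺)
open import Function using (_∘_; id; mk⇔)
open import Function.Bundles using (_↔_; Injection; Inverse)
open import Function.Definitions using (Injective)
open import Function.Properties.Inverse using (↔-refl; ↔-sym; ↔-trans; ↔⇒↣)
open import Relation.Nullary using (Dec; yes; no; ¬_; contradiction)
open import Relation.Nullary.Decidable using (isYes; _×-dec_; _⊎-dec_)
open import Relation.Binary using (tri<; tri≈; tri>)
open import Relation.Binary.Definitions using (DecidableEquality)
open import Relation.Binary.PropositionalEquality
  using (_≡_; _≢_; _≗_; refl; sym; trans; cong; cong₂; subst; module ≡-Reasoning)

State : ∀ {X} → OBDD X → Set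
State B = Fin (OBDD.n B) ⊎ Bool

module Cut {X : Set} (B : OBDD X) (c : ℕ) where
  open OBDD B

  next : (X → Bool) → Fin n → State B
  next α i = if α (label i) then hi i else lo i

  AfterCut : State B → Set
  AfterCut (inj₁ i) = c ≤ rank (label i)
  AfterCut (inj₂ _) = ⊤

  AgreeBefore AgreeAfter : (X → Bool) → (X → Bool) → Set
  AgreeBefore α β = ∀ x → rank x < c → α x ≡ β x
  AgreeAfter  α β = ∀ x → c ≤ rank x → α x ≡ β x

  successor-after : ∀ i y → c ≤ rank (label i)
                  → (∀ j → y ≡ inj₁ j → rank (label i) < rank (label j)) → AfterCut y
  successor-after i (inj₁ j) c≤i ord = ≤-trans c≤i (<⇒≤ (ord j refl))
  successor-after i (inj₂ _) c≤i ord = tt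

  next-after : ∀ α i → c ≤ rank (label i) → AfterCut (next α i)
  next-after α i c≤i with α (label i)
  ... | true  = successor-after i (hi i) c≤i (hi-ord i)
  ... | false = successor-after i (lo i) c≤i (lo-ord i)

  next-cong : ∀ α β i → α (label i) ≡ β (label i) → next α i ≡ next β i
  next-cong α β i eq = cong (λ v → if v then hi i else lo i) eq

  crossing : ∀ {α x b} → Reach α x b → State B
  crossing (sink b) = inj₂ b
  crossing (node i b ρ) with rank (label i) <? c
  ... | yes _ = crossing ρ
  ... | no  _ = inj₁ i

  crossing-after : ∀ {α x b} (ρ : Reach α x b) → AfterCut (crossing ρ)
  crossing-after (sink b) = tt
  crossing-after (node i b ρ) with rank (label i) <? c
  ... | yes _   = crossing-after ρ
  ... | no  i≮c = ≮⇒≥ i≮c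

  remainder : ∀ {α x b} (ρ : Reach α x b) → Reach α (crossing ρ) b
  remainder (sink b) = sink b
  remainder (node i b ρ) with rank (label i) <? c
  ... | yes _ = remainder ρ
  ... | no  _ = node i b ρ

  -- Before the cut a run only reads variables before the cut, so the
  -- crossing state depends only on that part of the assignment.
  crossing-before : ∀ {α β x y b b'} → AgreeBefore α β → (ρ : Reach α x b) (σ : Reach β y b')
                  → x ≡ y → crossing ρ ≡ crossing σ
  crossing-before agree (sink b)     (sink .b)     refl = refl
  crossing-before agree (sink _)     (node _ _ _)  ()
  crossing-before agree (node _ _ _) (sink _)      ()
  crossing-before {α} {β} agree (node i b ρ) (node .i b' σ) refl with rank (label i) <? c
  ... | yes i<c = crossing-before agree ρ σ (next-cong α β i (agree (label i) i<c))
  ... | no  _   = refl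

  graft : ∀ {α β x b b'} → AgreeBefore α β → (ρ : Reach α x b)
        → Reach β (crossing ρ) b' → Reach β x b'
  graft agree (sink b) τ = τ
  graft {α} {β} {b' = b'} agree (node i b ρ) τ with rank (label i) <? c
  ... | yes i<c = node i b' (subst (λ y → Reach β y b') (next-cong α β i (agree (label i) i<c)) (graft agree ρ τ))
  ... | no  _   = τ

  -- From a state after the cut a run only reads variables after the cut.
  transfer-after : ∀ {α β y b} → AgreeAfter α β → AfterCut y → Reach α y b → Reach β y b
  transfer-after agree _ (sink b) = sink b
  transfer-after {α} {β} agree c≤i (node i b ρ) =
    node i b (subst (λ y → Reach β y b) (next-cong α β i (agree (label i) c≤i))
                    (transfer-after agree (next-after α i c≤i) ρ))

state↔size : ∀ {X} (B : OBDD X) → State B ↔ Fin (OBDD.size B)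
state↔size B = ↔-trans (↔-refl ⊎-↔ ↔-sym 2↔Bool) (↔-sym +↔⊎)

-- If every s has
-- an accepted completion t₀, and no two distinct s have the same accepted
-- completions, then the OBDD has at least N nodes: the crossing state of the
-- accepted run of A s t₀ determines s.
fooling-bound : ∀ {X T : Set} (B : OBDD X) {P : (X → Bool) → Set} → Computes B P
  → (c : ℕ) {N : ℕ} (A : Fin N → T → X → Bool)
  → (∀ s t t' → Cut.AgreeBefore B c (A s t) (A s t'))
  → (∀ s s' t → Cut.AgreeAfter B c (A s t) (A s' t))
  → (t₀ : T) → (∀ s → P (A s t₀))
  → (∀ s s' → (∀ t → P (A s t) → P (A s' t)) → (∀ t → P (A s' t) → P (A s t)) → s ≡ s')
  → N ≤ OBDD.size B
fooling-bound {X} {T} B {P} computes c {N} A before after t₀ accepted separated =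
  injective⇒≤ {f = Injection.to (↔⇒↣ (state↔size B)) ∘ crossState}
    (λ eq → crossState-injective (Injection.injective (↔⇒↣ (state↔size B)) eq))
  where
  open OBDD B using (root; Reach)
  open Cut B c

  run : ∀ s t → P (A s t) → Reach (A s t) root true
  run s t = proj₂ (computes (A s t))

  crossState : Fin N → State B
  crossState s = crossing (run s t₀ (accepted s))

  same-completions : ∀ {s s'} → crossState s ≡ crossState s' → ∀ t → P (A s t) → P (A s' t)
  same-completions {s} {s'} eq t p = proj₁ (computes (A s' t)) (graft (before s' t₀ t) (run s' t₀ (accepted s')) tail-after)
    where
    ρ : Reach (A s t) root true
    ρ = run s t p
    same-crossing : crossing ρ ≡ crossState s'
    same-crossing = trans (crossing-before (before s t t₀) ρ (run s t₀ (accepted s)) refl) eq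
    tail-after : Reach (A s' t) (crossState s') true
    tail-after = subst (λ y → Reach (A s' t) y true) same-crossing
                  (transfer-after (after s s' t) (crossing-after ρ) (remainder ρ))

  crossState-injective : ∀ {s s'} → crossState s ≡ crossState s' → s ≡ s'
  crossState-injective {s} {s'} eq = separated s s' (same-completions eq) (same-completions (sym eq))

bits : ∀ {m} → Fin (2 ^ m) → Fin m → Bool
bits s i = Inverse.to 2↔Bool (finToFun s i)

funToFin-cong : ∀ {m n} {f f' : Fin m → Fin n} → f ≗ f' → funToFin f ≡ funToFin f'
funToFin-cong {zero}  eq = refl
funToFin-cong {suc m} eq = cong₂ combine (eq zero) (funToFin-cong (eq ∘ suc))

bits-injective : ∀ {m} {s s' : Fin (2 ^ m)} → (∀ (i : Fin m) → bits s i ≡ bits s' i) → s ≡ s'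
bits-injective {m} {s} {s'} eq = begin
  s                               ≡⟨ funToFin-finToFin {m} {2} s ⟨
  funToFin (finToFun {2} {m} s)   ≡⟨ funToFin-cong (Injection.injective (↔⇒↣ 2↔Bool) ∘ eq) ⟩
  funToFin (finToFun {2} {m} s')  ≡⟨ funToFin-finToFin {m} {2} s' ⟩
  s'                              ∎
  where open ≡-Reasoning

Joins : (G : Graph) → Graph.E G → Graph.V G → Graph.V G → Set
Joins G e x y = (end₁ e ≡ x × end₂ e ≡ y) ⊎ (end₁ e ≡ y × end₂ e ≡ x)
  where open Graph G

Adjacent : (G : Graph) → Graph.V G → Graph.V G → Set
Adjacent G x y = Σ (Graph.E G) λ e → Joins G e x y

record CrossingMatching (G : Graph) (g : Graph.V G → ℕ) (c m : ℕ) : Set where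
  field
    u v         : Fin m → Graph.V G
    adjacent    : ∀ i → Adjacent G (u i) (v i)
    u-before    : ∀ i → g (u i) < c
    v-after     : ∀ i → c ≤ g (v i)
    u-injective : Injective _≡_ _≡_ u
    v-injective : Injective _≡_ _≡_ v

  u≢v : ∀ i j → u i ≢ v j
  u≢v i j eq = <⇒≱ (u-before i) (subst (λ x → c ≤ g x) (sym eq) (v-after j))

-- The assignments fooling an OBDD for CNF(G) across a crossing matching:
-- u i gets the bit s i, v i the bit t i, every other vertex true; the edge
-- variables of the matching edges are false and all others true.  Then
-- CNF(G) holds iff s i ∨ t i for every i.
module MatchingAssignment {G : Graph} (_≟_ : DecidableEquality (Graph.V G))
                          {g : Graph.V G → ℕ} {c m : ℕ} (M : CrossingMatching G g c m) where
  open Graph G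
  open CrossingMatching M

  vertexValue : (s t : Fin m → Bool) → V → Bool
  vertexValue s t x with any? (λ i → u i ≟ x) | any? (λ j → v j ≟ x)
  ... | yes (i , _) | _           = s i
  ... | no _        | yes (j , _) = t j
  ... | no _        | no _        = true

  Matched : E → Set
  Matched e = ∃ λ i → Joins G e (u i) (v i)

  matched? : ∀ e → Dec (Matched e)
  matched? e = any? λ i → ((end₁ e ≟ u i) ×-dec (end₂ e ≟ v i)) ⊎-dec ((end₁ e ≟ v i) ×-dec (end₂ e ≟ u i))

  edgeValue : E → Bool
  edgeValue e with matched? e
  ... | yes _ = false
  ... | no _  = true

  assignment : (s t : Fin m → Bool) → CNFVar G → Bool
  assignment s t (inj₁ x) = vertexValue s t x
  assignment s t (inj₂ e) = edgeValue e

  value-u : ∀ s t i → vertexValue s t (u i) ≡ s i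
  value-u s t i with any? (λ i' → u i' ≟ u i) | any? (λ j → v j ≟ u i)
  ... | yes (i' , eq) | _ = cong s (u-injective eq)
  ... | no ¬u         | _ = contradiction (i , refl) ¬u

  value-v : ∀ s t j → vertexValue s t (v j) ≡ t j
  value-v s t j with any? (λ i → u i ≟ v j) | any? (λ j' → v j' ≟ v j)
  ... | yes (i , eq) | _              = contradiction eq (u≢v i j)
  ... | no _         | yes (j' , eq)  = cong t (v-injective eq)
  ... | no _         | no ¬v          = contradiction (j , refl) ¬v

  value-before : ∀ s t t' x → g x < c → vertexValue s t x ≡ vertexValue s t' x
  value-before s t t' x x<c with any? (λ i → u i ≟ x) | any? (λ j → v j ≟ x)
  ... | yes _ | _            = refl
  ... | no _  | yes (j , eq) = contradiction (subst (λ y → c ≤ g y) eq (v-after j)) (<⇒≱ x<c)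
  ... | no _  | no _         = refl

  value-after : ∀ s s' t x → c ≤ g x → vertexValue s t x ≡ vertexValue s' t x
  value-after s s' t x c≤x with any? (λ i → u i ≟ x) | any? (λ j → v j ≟ x)
  ... | yes (i , eq) | _ = contradiction (subst (λ y → c ≤ g y) (sym eq) c≤x) (<⇒≱ (u-before i))
  ... | no _  | yes _    = refl
  ... | no _  | no _     = refl

  edge-matched : ∀ e → Matched e → edgeValue e ≡ false
  edge-matched e matched with matched? e
  ... | yes _     = refl
  ... | no ¬match = contradiction matched ¬match

  edge-unmatched : ∀ e → ¬ Matched e → edgeValue e ≡ true
  edge-unmatched e unmatched with matched? e
  ... | yes match = contradiction match unmatched
  ... | no _      = refl

  clause-matched : ∀ s t e i → Joins G e (u i) (v i) → clause G (assignment s t) e ≡ s i ∨ t i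
  clause-matched s t e i joins rewrite edge-matched e (i , joins) = ends joins
    where
    value : ∀ {x y b} → x ≡ y → vertexValue s t y ≡ b → vertexValue s t x ≡ b
    value refl eq = eq
    ends : Joins G e (u i) (v i) → vertexValue s t (end₁ e) ∨ vertexValue s t (end₂ e) ≡ s i ∨ t i
    ends (inj₁ (e₁ , e₂)) = cong₂ _∨_ (value e₁ (value-u s t i)) (value e₂ (value-v s t i))
    ends (inj₂ (e₁ , e₂)) = trans (cong₂ _∨_ (value e₁ (value-v s t i)) (value e₂ (value-u s t i)))
                                  (∨-comm (t i) (s i))

  satisfied : ∀ s t → (∀ i → s i ∨ t i ≡ true) → SatCNF G (assignment s t)
  satisfied s t all-i e = by-cases (matched? e)
    where
    by-cases : Dec (Matched e) → clause G (assignment s t) e ≡ true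
    by-cases (yes (i , joins)) = trans (clause-matched s t e i joins) (all-i i)
    by-cases (no unmatched) rewrite edge-unmatched e unmatched = ∨-zeroʳ (vertexValue s t (end₁ e))

  satisfied⁻¹ : ∀ s t → SatCNF G (assignment s t) → ∀ i → s i ∨ t i ≡ true
  satisfied⁻¹ s t sat i = trans (sym (clause-matched s t e i joins)) (sat e)
    where
    e : E
    e = proj₁ (adjacent i)
    joins : Joins G e (u i) (v i)
    joins = proj₂ (adjacent i)

  -- The completion that is false exactly at i tests the bit s i.
  allTrueBut : Fin m → Fin m → Bool
  allTrueBut i j with j ≟F i
  ... | yes _ = false
  ... | no _  = true

  probe : ∀ s i → s i ≡ true → SatCNF G (assignment s (allTrueBut i))
  probe s i sᵢ = satisfied s (allTrueBut i) λ j → by-cases j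
    where
    by-cases : ∀ j → s j ∨ allTrueBut i j ≡ true
    by-cases j with j ≟F i
    ... | yes refl = trans (∨-identityʳ (s j)) sᵢ
    ... | no _     = ∨-zeroʳ (s j)

  probe⁻¹ : ∀ s i → SatCNF G (assignment s (allTrueBut i)) → s i ≡ true
  probe⁻¹ s i sat = by-cases (satisfied⁻¹ s (allTrueBut i) sat i)
    where
    by-cases : s i ∨ allTrueBut i i ≡ true → s i ≡ true
    by-cases eq with i ≟F i
    ... | yes _  = trans (sym (∨-identityʳ (s i))) eq
    ... | no i≢i = contradiction refl i≢i

matching-bound : ∀ {G : Graph} → DecidableEquality (Graph.V G)
  → (B : OBDD (CNFVar G)) → Computes B (SatCNF G)
  → ∀ {c m} → CrossingMatching G (λ x → OBDD.rank B (inj₁ x)) c m → 2 ^ m ≤ OBDD.size B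
matching-bound {G} _≟_ B computes {c} {m} M =
  fooling-bound B computes c (assignment ∘ bits) before after (λ _ → true)
    (λ s → satisfied (bits s) (λ _ → true) (λ i → ∨-zeroʳ (bits s i)))
    separated
  where
  open MatchingAssignment _≟_ M

  before : ∀ s t t' → Cut.AgreeBefore B c (assignment (bits s) t) (assignment (bits s) t')
  before s t t' (inj₁ x) x<c = value-before (bits s) t t' x x<c
  before s t t' (inj₂ e) _   = refl

  after : ∀ s s' t → Cut.AgreeAfter B c (assignment (bits s) t) (assignment (bits s') t)
  after s s' t (inj₁ x) c≤x = value-after (bits s) (bits s') t x c≤x
  after s s' t (inj₂ e) _   = refl

  separated : ∀ s s' → (∀ t → SatCNF G (assignment (bits s) t) → SatCNF G (assignment (bits s') t))
                     → (∀ t → SatCNF G (assignment (bits s') t) → SatCNF G (assignment (bits s) t))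
                     → s ≡ s'
  separated s s' to from = bits-injective λ i → ⇔→≡ (mk⇔
    (λ sᵢ → probe⁻¹ (bits s') i (to (allTrueBut i) (probe (bits s) i sᵢ)))
    (λ s'ᵢ → probe⁻¹ (bits s) i (from (allTrueBut i) (probe (bits s') i s'ᵢ))))

[,]-injective : ∀ {A B C : Set} {f : A → C} {g : B → C} → Injective _≡_ _≡_ f → Injective _≡_ _≡_ g
              → (∀ a b → f a ≢ g b) → Injective _≡_ _≡_ [ f , g ]
[,]-injective f-inj g-inj disjoint {inj₁ a} {inj₁ a'} eq = cong inj₁ (f-inj eq)
[,]-injective f-inj g-inj disjoint {inj₁ a} {inj₂ b}  eq = contradiction eq (disjoint a b)
[,]-injective f-inj g-inj disjoint {inj₂ b} {inj₁ a}  eq = contradiction (sym eq) (disjoint a b)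
[,]-injective f-inj g-inj disjoint {inj₂ b} {inj₂ b'} eq = cong inj₂ (g-inj eq)

combine-matchings : ∀ {G g c m₁ m₂} (M₁ : CrossingMatching G g c m₁) (M₂ : CrossingMatching G g c m₂)
  → (∀ i j → CrossingMatching.u M₁ i ≢ CrossingMatching.u M₂ j)
  → (∀ i j → CrossingMatching.v M₁ i ≢ CrossingMatching.v M₂ j)
  → CrossingMatching G g c (m₁ + m₂)
combine-matchings {G} {g} {c} {m₁} {m₂} M₁ M₂ u-disjoint v-disjoint = record
  { u           = u ∘ split
  ; v           = v ∘ split
  ; adjacent    = adjacent ∘ split
  ; u-before    = u-before ∘ split
  ; v-after     = v-after ∘ split
  ; u-injective = split-injective ∘ [,]-injective M₁.u-injective M₂.u-injective u-disjoint
  ; v-injective = split-injective ∘ [,]-injective M₁.v-injective M₂.v-injective v-disjoint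
  }
  where
  module M₁ = CrossingMatching M₁
  module M₂ = CrossingMatching M₂
  split : Fin (m₁ + m₂) → Fin m₁ ⊎ Fin m₂
  split = splitAt m₁
  split-injective : Injective _≡_ _≡_ split
  split-injective = Injection.injective (↔⇒↣ +↔⊎)
  u v : Fin m₁ ⊎ Fin m₂ → Graph.V G
  u = [ M₁.u , M₂.u ]
  v = [ M₁.v , M₂.v ]
  adjacent : ∀ x → Adjacent G (u x) (v x)
  adjacent (inj₁ i) = M₁.adjacent i
  adjacent (inj₂ j) = M₂.adjacent j
  u-before : ∀ x → g (u x) < c
  u-before (inj₁ i) = M₁.u-before i
  u-before (inj₂ j) = M₂.u-before j
  v-after : ∀ x → c ≤ g (v x)
  v-after (inj₁ i) = M₁.v-after i
  v-after (inj₂ j) = M₂.v-after j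

shrink : ∀ {G g c m k} → k ≤ m → CrossingMatching G g c m → CrossingMatching G g c k
shrink k≤m M = record
  { u = u ∘ first ; v = v ∘ first
  ; adjacent = adjacent ∘ first
  ; u-before = u-before ∘ first ; v-after = v-after ∘ first
  ; u-injective = inject≤-injective k≤m k≤m _ _ ∘ u-injective
  ; v-injective = inject≤-injective k≤m k≤m _ _ ∘ v-injective }
  where
  open CrossingMatching M
  first = λ i → inject≤ i k≤m

intermediate-value : ∀ (f : ℕ → ℕ) {k} b → (∀ c → f (suc c) ≤ suc (f c)) → f 0 ≤ k → k ≤ f b → ∃ λ c → f c ≡ k
intermediate-value f zero    step 0≤k k≤b = 0 , ≤-antisym 0≤k k≤b
intermediate-value f {k} (suc b) step 0≤k k≤b with k ≤? f b
... | yes k≤fb = intermediate-value f b step 0≤k k≤fb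
... | no  k≰fb = suc b , ≤-antisym (≤-trans (step b) (≰⇒> k≰fb)) k≤b

enumerate : ∀ {A : Set} {k} (xs : List A) → Unique xs → length xs ≡ k
          → Σ (Fin k → A) λ f → Injective _≡_ _≡_ f × (∀ i → f i ∈ xs)
enumerate xs unique refl = lookup xs , lookup-injective xs unique , ∈-lookup
  where
  lookup-injective : ∀ {A : Set} (xs : List A) → Unique xs → Injective _≡_ _≡_ (lookup xs)
  lookup-injective (x ∷ xs) (_ ∷ _)      {zero}  {zero}  _  = refl
  lookup-injective (x ∷ xs) (x∉ ∷ _)     {zero}  {suc j} eq = contradiction eq (All.lookup x∉ (∈-lookup j))
  lookup-injective (x ∷ xs) (x∉ ∷ _)     {suc i} {zero}  eq = contradiction (sym eq) (All.lookup x∉ (∈-lookup i))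
  lookup-injective (x ∷ xs) (_ ∷ unique) {suc i} {suc j} eq = cong suc (lookup-injective xs unique eq)

module Cuts {A : Set} (h : A → ℕ) (h-injective : Injective _≡_ _≡_ h) where

  below atOrAbove : ℕ → List A → List A
  below     c = filter (λ x → h x <? c)
  atOrAbove c = filter (λ x → c ≤? h x)

  below-accept : ∀ {c x xs} → h x < c → below c (x ∷ xs) ≡ x ∷ below c xs
  below-accept = filter-accept (λ y → h y <? _)
  below-reject : ∀ {c x xs} → c ≤ h x → below c (x ∷ xs) ≡ below c xs
  below-reject c≤x = filter-reject (λ y → h y <? _) (≤⇒≯ c≤x)

  split-length : ∀ c xs → length (below c xs) + length (atOrAbove c xs) ≡ length xs
  split-length c [] = refl
  split-length c (x ∷ xs) with h x <? c
  ... | yes x<c rewrite below-accept {xs = xs} x<c | filter-reject (λ y → c ≤? h y) {xs = xs} (<⇒≱ x<c)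
      = cong suc (split-length c xs)
  ... | no x≮c rewrite below-reject {xs = xs} (≮⇒≥ x≮c) | filter-accept (λ y → c ≤? h y) {xs = xs} (≮⇒≥ x≮c)
      = trans (+-suc _ _) (cong suc (split-length c xs))

  below-skip : ∀ c xs → All (λ y → h y ≢ c) xs → below (suc c) xs ≡ below c xs
  below-skip c [] [] = refl
  below-skip c (x ∷ xs) (x≢c ∷ rest) with h x <? c
  ... | yes x<c rewrite below-accept {xs = xs} x<c | below-accept {xs = xs} (m<n⇒m<1+n x<c)
      = cong (x ∷_) (below-skip c xs rest)
  ... | no x≮c rewrite below-reject {xs = xs} (≮⇒≥ x≮c)
                     | below-reject {xs = xs} (≤∧≢⇒< (≮⇒≥ x≮c) (x≢c ∘ sym))
      = below-skip c xs rest

  below-step : ∀ c xs → Unique xs → length (below (suc c) xs) ≤ suc (length (below c xs))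
  below-step c [] [] = z≤n
  below-step c (x ∷ xs) (x∉ ∷ unique) with h x <? c | h x ≟ℕ c
  ... | yes x<c | _ rewrite below-accept {xs = xs} x<c | below-accept {xs = xs} (m<n⇒m<1+n x<c)
      = s≤s (below-step c xs unique)
  ... | no x≮c | no x≢c rewrite below-reject {xs = xs} (≮⇒≥ x≮c)
                             | below-reject {xs = xs} (≤∧≢⇒< (≮⇒≥ x≮c) (x≢c ∘ sym))
      = below-step c xs unique
  ... | no x≮c | yes hx≡c rewrite below-reject {xs = xs} (≮⇒≥ x≮c)
                               | below-accept {xs = xs} (≤-reflexive (cong suc hx≡c))
      = s≤s (≤-reflexive (cong length (below-skip c xs (All.map others x∉))))
    where
    others : ∀ {y} → x ≢ y → h y ≢ c
    others x≢y hy≡c = x≢y (h-injective (trans hx≡c (sym hy≡c)))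

  bound : ∀ xs → ∃ λ b → All (λ y → h y < b) xs
  bound [] = 0 , []
  bound (x ∷ xs) with b , all< ← bound xs =
    suc (h x) ⊔ b , m≤m⊔n (suc (h x)) b ∷ All.map (λ y<b → <-≤-trans y<b (m≤n⊔m (suc (h x)) b)) all<

  balanced-cut : ∀ k xs → Unique xs → length xs ≡ k + k
               → ∃ λ c → length (below c xs) ≡ k × length (atOrAbove c xs) ≡ k
  balanced-cut k xs unique len = c , below-k , +-cancelˡ-≡ k _ _ (begin
      k + length (atOrAbove c xs)                   ≡⟨ cong (_+ length (atOrAbove c xs)) below-k ⟨
      length (below c xs) + length (atOrAbove c xs) ≡⟨ split-length c xs ⟩
      length xs                                     ≡⟨ len ⟩
      k + k                                         ∎)
    where
    open ≡-Reasoning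
    b : ℕ
    b = proj₁ (bound xs)
    below-0 : length (below 0 xs) ≤ k
    below-0 = ≤-trans (≤-reflexive (cong length (filter-none (λ y → h y <? 0) (All.universal (λ _ ()) xs)))) z≤n
    below-b : k ≤ length (below b xs)
    below-b = ≤-trans (m≤m+n k k) (≤-reflexive (sym (trans (cong length (filter-all (λ y → h y <? b) (proj₂ (bound xs)))) len)))
    ivt : ∃ λ c → length (below c xs) ≡ k
    ivt = intermediate-value (λ c → length (below c xs)) b (λ c → below-step c xs unique) below-0 below-b
    c : ℕ
    c = proj₁ ivt
    below-k : length (below c xs) ≡ k
    below-k = proj₂ ivt

clique-matching : ∀ {G : Graph} (g : Graph.V G → ℕ) → Injective _≡_ _≡_ g
  → ∀ k (xs : List (Graph.V G)) → Unique xs → length xs ≡ k + k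
  → (∀ {x y} → x ∈ xs → y ∈ xs → x ≢ y → Adjacent G x y)
  → ∃ λ c → CrossingMatching G g c k
clique-matching {G} g g-injective k xs unique len adjacent = c , record
  { u = u ; v = v
  ; adjacent    = λ i → adjacent (proj₁ (u-facts i)) (proj₁ (v-facts i)) (u≢v i)
  ; u-before    = proj₂ ∘ u-facts
  ; v-after     = proj₂ ∘ v-facts
  ; u-injective = proj₁ (proj₂ lower)
  ; v-injective = proj₁ (proj₂ upper) }
  where
  open Cuts g g-injective
  cut : ∃ λ c → length (below c xs) ≡ k × length (atOrAbove c xs) ≡ k
  cut = balanced-cut k xs unique len
  c : ℕ
  c = proj₁ cut
  lower : Σ (Fin k → Graph.V G) λ f → Injective _≡_ _≡_ f × (∀ i → f i ∈ below c xs)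
  lower = enumerate (below c xs) (filter⁺ (λ y → g y <? c) unique) (proj₁ (proj₂ cut))
  upper : Σ (Fin k → Graph.V G) λ f → Injective _≡_ _≡_ f × (∀ i → f i ∈ atOrAbove c xs)
  upper = enumerate (atOrAbove c xs) (filter⁺ (λ y → c ≤? g y) unique) (proj₂ (proj₂ cut))
  u v : Fin k → Graph.V G
  u = proj₁ lower
  v = proj₁ upper
  u-facts : ∀ i → u i ∈ xs × g (u i) < c
  u-facts i = ∈-filter⁻ (λ y → g y <? c) (proj₂ (proj₂ lower) i)
  v-facts : ∀ i → v i ∈ xs × c ≤ g (v i)
  v-facts i = ∈-filter⁻ (λ y → c ≤? g y) (proj₂ (proj₂ upper) i)
  u≢v : ∀ i → u i ≢ v i
  u≢v i eq = <⇒≱ (proj₂ (u-facts i)) (subst (λ y → c ≤ g y) (sym eq) (proj₂ (v-facts i)))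

transpose-left : ∀ {k} (i j : Fin k) → transpose i j i ≡ j
transpose-left i j with i ≟F i
... | yes _   = refl
... | no i≢i  = contradiction refl i≢i

transpose-other : ∀ {k} (i j l : Fin k) → l ≢ i → l ≢ j → transpose i j l ≡ l
transpose-other i j l l≢i l≢j with l ≟F i
... | yes l≡i = contradiction l≡i l≢i
... | no _ with l ≟F j
...   | yes l≡j = contradiction l≡j l≢j
...   | no _    = refl

transpose-injective : ∀ {k} (i j : Fin k) → Injective _≡_ _≡_ (transpose i j)
transpose-injective i j {l} {l'} eq = begin
  l                                     ≡⟨ transpose-inverse j i ⟨
  transpose j i (transpose i j l)       ≡⟨ cong (transpose j i) eq ⟩
  transpose j i (transpose i j l')      ≡⟨ transpose-inverse j i ⟩
  l'                                    ∎
  where open ≡-Reasoning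

-- Every partial injection C on Fin k extends to an injection: process the
-- points one by one, moving each constrained point to its target by a
-- transposition, which disturbs no earlier constrained point.
module PartialInjection {k : ℕ} (C : Fin k → Maybe (Fin k))
                        (C-injective : ∀ {s t j} → C s ≡ just j → C t ≡ just j → s ≡ t) where

  extendAlong : List (Fin k) → Fin k → Fin k
  extendAlong []       = id
  extendAlong (t ∷ ts) with C t
  ... | just j  = transpose (extendAlong ts t) j ∘ extendAlong ts
  ... | nothing = extendAlong ts

  extendAlong-injective : ∀ ts → Injective _≡_ _≡_ (extendAlong ts)
  extendAlong-injective []       eq = eq
  extendAlong-injective (t ∷ ts) eq with C t
  ... | just j  = extendAlong-injective ts (transpose-injective (extendAlong ts t) j eq)
  ... | nothing = extendAlong-injective ts eq

  extendAlong-extends : ∀ ts {s j} → s ∈ ts → C s ≡ just j → extendAlong ts s ≡ j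
  extendAlong-extends (t ∷ ts) {s} {j} s∈ Cs with C t in Ct
  extendAlong-extends (t ∷ ts) (Any.here refl) Cs | nothing  = contradiction (trans (sym Ct) Cs) λ ()
  extendAlong-extends (t ∷ ts) (Any.there s∈)  Cs | nothing  = extendAlong-extends ts s∈ Cs
  extendAlong-extends (t ∷ ts) {s} {j} s∈ Cs | just j₀ with s ≟F t
  ... | yes refl with refl ← trans (sym Ct) Cs = transpose-left (extendAlong ts s) j
  ... | no s≢t with s∈
  ...   | Any.here s≡t = contradiction s≡t s≢t
  ...   | Any.there s∈ts = trans (cong (transpose (extendAlong ts t) j₀) πs≡j)
                             (transpose-other (extendAlong ts t) j₀ j
                               (λ j≡πt → s≢t (extendAlong-injective ts (trans πs≡j j≡πt)))
                               (λ j≡j₀ → s≢t (C-injective Cs (trans Ct (cong just (sym j≡j₀))))))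
    where
    πs≡j : extendAlong ts s ≡ j
    πs≡j = extendAlong-extends ts s∈ts Cs

  extension : Σ (Fin k → Fin k) λ π → Injective _≡_ _≡_ π × (∀ {t j} → C t ≡ just j → π t ≡ j)
  extension = extendAlong (allFin k) , extendAlong-injective (allFin k) , extendAlong-extends (allFin k) (∈-allFin _)

-- Threading k disjoint strands through copies of Fin k indexed by A: an
-- injection π a for each a, such that the strand t passes through the
-- prescribed point p t.
record Threading {A : Set} {k : ℕ} (p : Fin k → A × Fin k) : Set where
  field
    π           : A → Fin k → Fin k
    π-injective : ∀ a → Injective _≡_ _≡_ (π a)
    π-passes    : ∀ t → π (proj₁ (p t)) t ≡ proj₂ (p t)

-- Distinct prescribed points can always be threaded: at each a the points
-- lying there form a partial injection, which extends to an injection.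
threads : ∀ {A : Set} {k} → DecidableEquality A → (p : Fin k → A × Fin k) → Injective _≡_ _≡_ p → Threading p
threads {A} {k} _≟_ p p-injective = record
  { π           = λ a → proj₁ (extension a)
  ; π-injective = λ a → proj₁ (proj₂ (extension a))
  ; π-passes    = λ t → proj₂ (proj₂ (extension (proj₁ (p t)))) (constraint-self t) }
  where
  constraint : A → Fin k → Maybe (Fin k)
  constraint a t with proj₁ (p t) ≟ a
  ... | yes _ = just (proj₂ (p t))
  ... | no _  = nothing

  constraint-at : ∀ {a t j} → constraint a t ≡ just j → p t ≡ (a , j)
  constraint-at {a} {t} eq with proj₁ (p t) ≟ a
  constraint-at refl | yes refl = refl
  constraint-at ()   | no _

  constraint-self : ∀ t → constraint (proj₁ (p t)) t ≡ just (proj₂ (p t))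
  constraint-self t with proj₁ (p t) ≟ proj₁ (p t)
  ... | yes _ = refl
  ... | no ne = contradiction refl ne

  extension : ∀ a → Σ (Fin k → Fin k) λ π → Injective _≡_ _≡_ π × (∀ {t j} → constraint a t ≡ just j → π t ≡ j)
  extension a = PartialInjection.extension (constraint a)
                  (λ eq eq' → p-injective (trans (constraint-at eq) (sym (constraint-at eq'))))

CTVertex : ℕ → ℕ → Set
CTVertex r k = Node r × Fin k

_≟N_ : ∀ {r} → DecidableEquality (Node r)
here   ≟N here    = yes refl
here   ≟N go _ _  = no λ ()
go _ _ ≟N here    = no λ ()
go b x ≟N go b' y with b ≟B b' | x ≟N y
... | yes refl | yes refl = yes refl
... | no b≢b'  | _        = no λ { refl → b≢b' refl }
... | yes _    | no x≢y   = no λ { refl → x≢y refl }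

_≟V_ : ∀ {r k} → DecidableEquality (CTVertex r k)
_≟V_ = ≡-dec _≟N_ _≟F_

tree-adjacent : ∀ {r k} {a b : Node r} (i j : Fin k) → Child a b → Adjacent (CT r k) (a , i) (b , j)
tree-adjacent i j a→b = tree _ _ a→b i j , inj₁ (refl , refl)

tree-adjacent˘ : ∀ {r k} {a b : Node r} (i j : Fin k) → Child b a → Adjacent (CT r k) (a , i) (b , j)
tree-adjacent˘ i j b→a = tree _ _ b→a j i , inj₂ (refl , refl)

clique-adjacent : ∀ {r k} (a : Node r) {i j : Fin k} → i ≢ j → Adjacent (CT r k) (a , i) (a , j)
clique-adjacent a {i} {j} i≢j with <-cmp i j
... | tri< i<j _ _ = clique a i j i<j , inj₁ (refl , refl)
... | tri≈ _ i≡j _ = contradiction i≡j i≢j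
... | tri> _ _ j<i = clique a j i j<i , inj₂ (refl , refl)

into : ∀ {r k} → Bool → CTVertex r k → CTVertex (suc r) k
into b (x , i) = go b x , i

into-injective : ∀ {r k} b → Injective _≡_ _≡_ (into {r} {k} b)
into-injective b refl = refl

into-adjacent : ∀ {r k} b {x y : CTVertex r k} → Adjacent (CT r k) x y → Adjacent (CT (suc r) k) (into b x) (into b y)
into-adjacent b (e , joins) = edge e , ends e joins
  where
  edge : ∀ {r k} → CTEdge r k → CTEdge (suc r) k
  edge (clique a i j i<j)  = clique (go b a) i j i<j
  edge (tree a c a→c i j)  = tree (go b a) (go b c) (child-go b a→c) i j
  ends : ∀ {r k} {x y} (e : CTEdge r k) → Joins (CT r k) e x y → Joins (CT (suc r) k) (edge e) (into b x) (into b y)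
  ends (clique a i j _) (inj₁ (refl , refl)) = inj₁ (refl , refl)
  ends (clique a i j _) (inj₂ (refl , refl)) = inj₂ (refl , refl)
  ends (tree a c _ i j) (inj₁ (refl , refl)) = inj₁ (refl , refl)
  ends (tree a c _ i j) (inj₂ (refl , refl)) = inj₂ (refl , refl)

matching-into : ∀ {r k g c m} b → CrossingMatching (CT r k) (g ∘ into b) c m → CrossingMatching (CT (suc r) k) g c m
matching-into b M = record
  { u = into b ∘ u ; v = into b ∘ v
  ; adjacent = into-adjacent b ∘ adjacent
  ; u-before = u-before ; v-after = v-after
  ; u-injective = u-injective ∘ into-injective b
  ; v-injective = v-injective ∘ into-injective b }
  where open CrossingMatching M

-- Base case: the root clique of CT (suc r) k and the clique of its first
-- child are 2k pairwise adjacent vertices, so some cut is crossed by a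
-- matching of size k.
base-matching : ∀ {r k} (g : CTVertex (suc r) k → ℕ) → Injective _≡_ _≡_ g
              → ∃ λ c → CrossingMatching (CT (suc r) k) g c k
base-matching {r} {k} g g-injective =
  clique-matching g g-injective k (tabulate (top ∘ splitAt k))
    (tabulate⁺ (Injection.injective (↔⇒↣ +↔⊎) ∘ top-injective))
    (length-tabulate (top ∘ splitAt k))
    adjacent
  where
  top : Fin k ⊎ Fin k → CTVertex (suc r) k
  top (inj₁ i) = here , i
  top (inj₂ i) = go false here , i

  top-injective : Injective _≡_ _≡_ top
  top-injective {inj₁ i} {inj₁ .i} refl = refl
  top-injective {inj₂ i} {inj₂ .i} refl = refl

  top-adjacent : ∀ a b → top a ≢ top b → Adjacent (CT (suc r) k) (top a) (top b)
  top-adjacent (inj₁ i) (inj₁ j) ne = clique-adjacent here (ne ∘ cong (here ,_))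
  top-adjacent (inj₂ i) (inj₂ j) ne = clique-adjacent (go false here) (ne ∘ cong (go false here ,_))
  top-adjacent (inj₁ i) (inj₂ j) _  = tree-adjacent i j (child-here false)
  top-adjacent (inj₂ i) (inj₁ j) _  = tree-adjacent˘ i j (child-here false)

  adjacent : ∀ {x y} → x ∈ tabulate (top ∘ splitAt k) → y ∈ tabulate (top ∘ splitAt k) → x ≢ y → Adjacent (CT (suc r) k) x y
  adjacent x∈ y∈ x≢y with ∈-tabulate⁻ x∈ | ∈-tabulate⁻ y∈
  ... | a , refl | b , refl = top-adjacent (splitAt k a) (splitAt k b) x≢y

data _≼_ : ∀ {r} → Node r → Node r → Set where
  root≼ : ∀ {r} {x : Node r} → here ≼ x
  go≼   : ∀ {r} b {a x : Node r} → a ≼ x → go b a ≼ go b x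

climb : ∀ {r} (f : Node r → Bool) (x : Node r) → f x ≢ f here
      → Σ (Node r) λ p → Σ (Node r) λ ch → Child p ch × p ≼ x × ch ≼ x × f p ≢ f ch
climb f here differs = contradiction refl differs
climb f (go b x) differs with f (go b here) ≟B f here
... | no  top-differs = here , go b here , child-here b , root≼ , go≼ b root≼ , top-differs ∘ sym
... | yes top-same with climb (f ∘ go b) x (λ same → differs (trans same top-same))
...   | p , ch , p→ch , p≼x , ch≼x , edge-differs =
        go b p , go b ch , child-go b p→ch , go≼ b p≼x , go≼ b ch≼x , edge-differs

Grandchild : Set
Grandchild = Bool × Bool

descend : ∀ {r k} → Grandchild → CTVertex r k → CTVertex (suc (suc r)) k
descend q = into (proj₁ q) ∘ into (proj₂ q)

descend-injective : ∀ {r k} q → Injective _≡_ _≡_ (descend {r} {k} q)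
descend-injective q = into-injective (proj₂ q) ∘ into-injective (proj₁ q)

matching-descend : ∀ {r k g c m} q → CrossingMatching (CT r k) (g ∘ descend q) c m
                 → CrossingMatching (CT (suc (suc r)) k) g c m
matching-descend q = matching-into (proj₁ q) ∘ matching-into (proj₂ q)

data Inside {r} : Grandchild → Node (suc (suc r)) → Set where
  inside : ∀ {b b'} (y : Node r) → Inside (b , b') (go b (go b' y))

inside? : ∀ {r} q (x : Node (suc (suc r))) → Dec (Inside q x)
inside? q here              = no λ ()
inside? q (go _ here)       = no λ ()
inside? q (go β (go β' y)) with β ≟B proj₁ q | β' ≟B proj₂ q
... | yes refl | yes refl = yes (inside y)
... | no β≢    | _        = no λ { (inside _) → β≢ refl }
... | yes _    | no β'≢   = no λ { (inside _) → β'≢ refl }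

inside-unique : ∀ {r q q'} {x : Node (suc (suc r))} → Inside q x → Inside q' x → q ≡ q'
inside-unique (inside y) (inside .y) = refl

inside-descend : ∀ {r k} q (x : CTVertex r k) → Inside q (proj₁ (descend q x))
inside-descend q (y , i) = inside y

inside-≼ : ∀ {r q} {a x : Node (suc (suc r))} → a ≼ x → Inside q a → Inside q x
inside-≼ (go≼ b (go≼ b' _)) (inside _) = inside _

-- Let three distinct grandchild subtrees E, M, L carry
-- crossing matchings at cuts cE ≤ cM ≤ cL, those of E and L of size k.  The
-- k vertices of E before cE and the k vertices of L after cL are joined by k
-- disjoint strands through the tree outside M; each strand crosses cM, which
-- adds k edges to the matching of M.
module Step {r k : ℕ} (g : CTVertex (suc (suc r)) k → ℕ) {qE qM qL : Grandchild}
            (E≢M : qE ≢ qM) (L≢M : qL ≢ qM) (E≢L : qE ≢ qL)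
            {cE cM cL mM : ℕ} (cE≤cM : cE ≤ cM) (cM≤cL : cM ≤ cL)
            (ME : CrossingMatching (CT r k) (g ∘ descend qE) cE k)
            (MM : CrossingMatching (CT r k) (g ∘ descend qM) cM mM)
            (ML : CrossingMatching (CT r k) (g ∘ descend qL) cL k) where

  T : Set
  T = Node (suc (suc r))

  private
    module ME = CrossingMatching ME
    module ML = CrossingMatching ML

  start end : Fin k → CTVertex (suc (suc r)) k
  start = descend qE ∘ ME.u
  end   = descend qL ∘ ML.v

  module TE = Threading (threads _≟N_ start (ME.u-injective ∘ descend-injective qE))
  module TL = Threading (threads _≟N_ end (ML.v-injective ∘ descend-injective qL))

  Π : T → Fin k → Fin k
  Π x with inside? qL x
  ... | yes _ = TL.π x
  ... | no _  = TE.π x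

  Π-injective : ∀ x → Injective _≡_ _≡_ (Π x)
  Π-injective x with inside? qL x
  ... | yes _ = TL.π-injective x
  ... | no _  = TE.π-injective x

  strand : Fin k → T → CTVertex (suc (suc r)) k
  strand t x = x , Π x t

  -- Each strand passes through its start and its end (they lie in the
  -- distinct subtrees E and L), and distinct strands never meet.
  strand-start : ∀ t → strand t (proj₁ (start t)) ≡ start t
  strand-start t with inside? qL (proj₁ (start t))
  ... | yes inL = contradiction (inside-unique (inside-descend qE (ME.u t)) inL) E≢L
  ... | no _    = cong (_ ,_) (TE.π-passes t)

  strand-end : ∀ t → strand t (proj₁ (end t)) ≡ end t
  strand-end t with inside? qL (proj₁ (end t))
  ... | yes _  = cong (_ ,_) (TL.π-passes t)
  ... | no ¬inL = contradiction (inside-descend qL (ML.v t)) ¬inL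

  strand-injective : ∀ {t s x y} → strand t x ≡ strand s y → t ≡ s
  strand-injective {x = x} eq with refl , Π-eq ← ,-injective eq = Π-injective x Π-eq

  isBefore : Fin k → T → Bool
  isBefore t x = isYes (g (strand t x) <? cM)

  isBefore-true⇒ : ∀ t x → isBefore t x ≡ true → g (strand t x) < cM
  isBefore-true⇒ t x eq with g (strand t x) <? cM
  ... | yes x<c = x<c

  isBefore-false⇒ : ∀ t x → isBefore t x ≡ false → cM ≤ g (strand t x)
  isBefore-false⇒ t x eq with g (strand t x) <? cM
  ... | no x≮c = ≮⇒≥ x≮c

  ⇒isBefore-true : ∀ t x → g (strand t x) < cM → isBefore t x ≡ true
  ⇒isBefore-true t x x<c with g (strand t x) <? cM
  ... | yes _   = refl
  ... | no x≮c = contradiction x<c x≮c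

  ⇒isBefore-false : ∀ t x → cM ≤ g (strand t x) → isBefore t x ≡ false
  ⇒isBefore-false t x c≤x with g (strand t x) <? cM
  ... | yes x<c = contradiction c≤x (<⇒≱ x<c)
  ... | no _    = refl

  start-before : ∀ t → isBefore t (proj₁ (start t)) ≡ true
  start-before t = ⇒isBefore-true t _ (subst (λ y → g y < cM) (sym (strand-start t)) (<-≤-trans (ME.u-before t) cE≤cM))

  end-after : ∀ t → isBefore t (proj₁ (end t)) ≡ false
  end-after t = ⇒isBefore-false t _ (subst (λ y → cM ≤ g y) (sym (strand-end t)) (≤-trans cM≤cL (ML.v-after t)))

  record Crossing (t : Fin k) : Set where
    field
      low high     : T
      adjacent     : Adjacent (CT (suc (suc r)) k) (strand t low) (strand t high)
      low-before   : g (strand t low) < cM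
      high-after   : cM ≤ g (strand t high)
      low-outside  : ¬ Inside qM low
      high-outside : ¬ Inside qM high

  orient : ∀ t {p ch} → Child p ch → isBefore t p ≢ isBefore t ch → ¬ Inside qM p → ¬ Inside qM ch → Crossing t
  orient t {p} {ch} p→ch differs p-out ch-out with isBefore t p in p? | isBefore t ch in ch?
  ... | true  | true  = contradiction refl differs
  ... | false | false = contradiction refl differs
  ... | true  | false = record
    { low = p ; high = ch ; adjacent = tree-adjacent _ _ p→ch
    ; low-before = isBefore-true⇒ t p p? ; high-after = isBefore-false⇒ t ch ch?
    ; low-outside = p-out ; high-outside = ch-out }
  ... | false | true  = record
    { low = ch ; high = p ; adjacent = tree-adjacent˘ _ _ p→ch
    ; low-before = isBefore-true⇒ t ch ch? ; high-after = isBefore-false⇒ t p p?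
    ; low-outside = ch-out ; high-outside = p-out }

  -- If the strand t is before the cut at a node x of a subtree other than M
  -- but not at the root (or vice versa), it crosses on the root path of x,
  -- which avoids M.
  crossing-above : ∀ t {q x} → Inside q x → q ≢ qM → isBefore t x ≢ isBefore t here → Crossing t
  crossing-above t {q} {x} in-q q≢M differs with climb (isBefore t) x differs
  ... | p , ch , p→ch , p≼x , ch≼x , edge-differs = orient t p→ch edge-differs (outside p≼x) (outside ch≼x)
    where
    outside : ∀ {a} → a ≼ x → ¬ Inside qM a
    outside a≼x in-M = q≢M (inside-unique in-q (inside-≼ a≼x in-M))

  -- The strand t is before the cut at its start and after it at its end, so
  -- it differs from the root at one of them.
  crossing : ∀ t → Crossing t
  crossing t with isBefore t here in root?
  ... | true  = crossing-above t (inside-descend qL (ML.v t)) L≢M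
                  λ same → contradiction (trans (sym (end-after t)) (trans same root?)) λ ()
  ... | false = crossing-above t (inside-descend qE (ME.u t)) E≢M
                  λ same → contradiction (trans (sym (start-before t)) (trans same root?)) λ ()

  strands : CrossingMatching (CT (suc (suc r)) k) g cM k
  strands = record
    { u = λ t → strand t (low (crossing t)) ; v = λ t → strand t (high (crossing t))
    ; adjacent = adjacent ∘ crossing
    ; u-before = low-before ∘ crossing ; v-after = high-after ∘ crossing
    ; u-injective = strand-injective ; v-injective = strand-injective }
    where open Crossing

  enlarged : CrossingMatching (CT (suc (suc r)) k) g cM (k + mM)
  enlarged = combine-matchings strands (matching-descend qM MM)
    (λ t i eq → Crossing.low-outside (crossing t) (subst (Inside qM) (sym (cong proj₁ eq)) (inside-descend qM (MM.u i))))
    (λ t i eq → Crossing.high-outside (crossing t) (subst (Inside qM) (sym (cong proj₁ eq)) (inside-descend qM (MM.v i))))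
    where module MM = CrossingMatching MM

record Sorted3 {A : Set} (c : A → ℕ) : Set where
  constructor sorted3
  field
    low mid high : A
    low≢mid  : low ≢ mid
    high≢mid : high ≢ mid
    low≢high : low ≢ high
    low≤mid  : c low ≤ c mid
    mid≤high : c mid ≤ c high

sort3 : ∀ {A : Set} (c : A → ℕ) {a b d : A} → a ≢ b → a ≢ d → b ≢ d → Sorted3 c
sort3 c {a} {b} {d} a≢b a≢d b≢d with ≤-total (c a) (c b) | ≤-total (c b) (c d) | ≤-total (c a) (c d)
... | inj₁ a≤b | inj₁ b≤d | _        = sorted3 a b d a≢b (b≢d ∘ sym) a≢d a≤b b≤d
... | inj₁ a≤b | inj₂ d≤b | inj₁ a≤d = sorted3 a d b a≢d b≢d a≢b a≤d d≤b
... | inj₁ a≤b | inj₂ d≤b | inj₂ d≤a = sorted3 d a b (a≢d ∘ sym) (a≢b ∘ sym) (b≢d ∘ sym) d≤a a≤b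
... | inj₂ b≤a | _        | inj₁ a≤d = sorted3 b a d (a≢b ∘ sym) (a≢d ∘ sym) b≢d b≤a a≤d
... | inj₂ b≤a | inj₁ b≤d | inj₂ d≤a = sorted3 b d a b≢d a≢d (a≢b ∘ sym) b≤d d≤a
... | inj₂ b≤a | inj₂ d≤b | inj₂ _   = sorted3 d b a (b≢d ∘ sym) a≢b (a≢d ∘ sym) d≤b b≤a

record LargeMatching (r k : ℕ) (g : CTVertex r k → ℕ) : Set where
  constructor large
  field
    cut size   : ℕ
    size-large : ⌈ r /2⌉ * k ≤ size
    matching   : CrossingMatching (CT r k) g cut size

large-base : ∀ {r k} (g : CTVertex (suc r) k → ℕ) → Injective _≡_ _≡_ g → ⌈ suc r /2⌉ ≡ 1 → LargeMatching (suc r) k g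
large-base {r} {k} g g-injective half≡1 =
  large (proj₁ base) k (≤-reflexive (trans (cong (_* k) half≡1) (+-identityʳ k))) (proj₂ base)
  where
  base : ∃ λ c → CrossingMatching (CT (suc r) k) g c k
  base = base-matching g g-injective

grow : ∀ {r k} (g : CTVertex (suc (suc (suc r))) k → ℕ)
     → (∀ q → LargeMatching (suc r) k (g ∘ descend q)) → LargeMatching (suc (suc (suc r))) k g
grow {r} {k} g below =
  large (cut M) (k + size M) (+-monoʳ-≤ k (size-large M))
        (Step.enlarged g low≢mid high≢mid low≢high low≤mid mid≤high
                   (shrink (enough E) (matching E)) (matching M) (shrink (enough L) (matching L)))
  where
  open LargeMatching
  open Sorted3 (sort3 (cut ∘ below) {false , false} {false , true} {true , false} (λ ()) (λ ()) (λ ()))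
  E : LargeMatching (suc r) k (g ∘ descend low)
  E = below low
  M : LargeMatching (suc r) k (g ∘ descend mid)
  M = below mid
  L : LargeMatching (suc r) k (g ∘ descend high)
  L = below high
  enough : ∀ {q} (N : LargeMatching (suc r) k (g ∘ descend q)) → k ≤ size N
  enough N = ≤-trans (m≤m+n k _) (size-large N)

large-matching : ∀ r k (g : CTVertex r k → ℕ) → Injective _≡_ _≡_ g → LargeMatching r k g
large-matching zero k g g-injective = large 0 0 z≤n (record
  { u = λ () ; v = λ () ; adjacent = λ () ; u-before = λ () ; v-after = λ ()
  ; u-injective = λ { {()} } ; v-injective = λ { {()} } })
large-matching 1 k g g-injective = large-base g g-injective refl
large-matching 2 k g g-injective = large-base g g-injective refl
large-matching (suc (suc (suc r))) k g g-injective = grow g λ q →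
  large-matching (suc r) k (g ∘ descend q) (descend-injective q ∘ g-injective)

r≤⌈r/2⌉+⌈r/2⌉ : ∀ r → r ≤ ⌈ r /2⌉ + ⌈ r /2⌉
r≤⌈r/2⌉+⌈r/2⌉ r = begin
  r                       ≡⟨ ⌊n/2⌋+⌈n/2⌉≡n r ⟨
  ⌊ r /2⌋ + ⌈ r /2⌉       ≤⟨ +-monoˡ-≤ ⌈ r /2⌉ (⌊n/2⌋≤⌈n/2⌉ r) ⟩
  ⌈ r /2⌉ + ⌈ r /2⌉       ∎
  where open ≤-Reasoning

theorem1 : (r k : ℕ) → 1 ≤ k → (B : OBDD (FVar r k)) → Computes B (F r k)
           → 2 ^ (r * k) ≤ OBDD.size B * OBDD.size B
theorem1 r k _ B computes = begin
  2 ^ (r * k)                     ≤⟨ ^-monoʳ-≤ 2 r*k≤m+m ⟩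
  2 ^ (m + m)                     ≡⟨ ^-distribˡ-+-* 2 m m ⟩
  2 ^ m * 2 ^ m                   ≤⟨ *-mono-≤ 2^m≤size 2^m≤size ⟩
  OBDD.size B * OBDD.size B       ∎
  where
  open ≤-Reasoning
  LM : LargeMatching r k (λ x → OBDD.rank B (inj₁ x))
  LM = large-matching r k (λ x → OBDD.rank B (inj₁ x)) (inj₁-injective ∘ OBDD.rank-inj B)
  m : ℕ
  m = LargeMatching.size LM
  2^m≤size : 2 ^ m ≤ OBDD.size B
  2^m≤size = matching-bound _≟V_ B computes (LargeMatching.matching LM)
  r*k≤m+m : r * k ≤ m + m
  r*k≤m+m = begin
    r * k                                 ≤⟨ *-monoˡ-≤ k (r≤⌈r/2⌉+⌈r/2⌉ r) ⟩
    (⌈ r /2⌉ + ⌈ r /2⌉) * k               ≡⟨ *-distribʳ-+ k ⌈ r /2⌉ ⌈ r /2⌉ ⟩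
    ⌈ r /2⌉ * k + ⌈ r /2⌉ * k             ≤⟨ +-mono-≤ (LargeMatching.size-large LM) (LargeMatching.size-large LM) ⟩
    m + m                                 ∎
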